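{- Let $m=2n+1\ge 5$ be odd. For every unbalanced ring $\varphi$ (as defined in the context) there is a finite sequence of rings $\varphi^0,\varphi^1,\dots,\varphi^k,\varphi^{k+1}=\varphi$ such that $\varphi^0$ is the balanced ring and $\varphi^{j}$ is a transformation of $\varphi^{j-1}$ for every $j=1,\dots,k+1$. That is, $\varphi$ is obtained from the balanced ring by finitely many successive transformations.
   Context: Indices are taken cyclically modulo $m$. A ring is a sequence $\varphi=(\mathcal A_1,\dots,\mathcal A_m)$ of pairwise disjoint finite vertex sets such that $|\mathcal A_i|\ge 1$ and $|\mathcal A_i|+|\mathcal A_{i+1}|\le m$ for all $i$, and $\sum_{i=1}^m|\mathcal A_i| = m\lfloor m/2\rfloor$. It is balanced if $|\mathcal A_i|=\lfloor m/2\rfloor$ for all $i$, unbalanced otherwise (rings are considered through the cardinalities $|\mathcal A_i|$). A ring $\varphi'=(\mathcal A'_1,\dots,\mathcal A'_m)$ is a transformation of a ring $\varphi=(\mathcal A_1,\dots,\mathcal A_m)$ if there is a unique index $i$ such that $|\mathcal A'_i|=|\mathcal A_i|-1$ and either $|\mathcal A'_{i+1}|=|\mathcal A_{i+1}|+1$ or $|\mathcal A'_{i-1}|=|\mathcal A_{i-1}|+1$, all other cardinalities being unchanged. -}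

module Defs where

open import Data.Nat using (ℕ; zero; suc; _+_; _*_; _∸_; _≤_; NonZero)
open import Data.Nat.DivMod using (_/_; _%_; m%n<n)
open import Data.Fin using (Fin; toℕ; fromℕ<; inject₁; fromℕ) renaming (zero to fzero; suc to fsuc)
open import Data.List using (map; allFin)
open import Data.Nat.ListAction using (sum)
open import Data.Product using (Σ; _×_; ∃-syntax)
open import Data.Sum using (_⊎_)
open import Relation.Binary.PropositionalEquality using (_≡_; _≢_)
open import Relation.Nullary using (¬_)

-- A ring is considered only through its cardinalities |A_1|,…,|A_m|,
-- indexed by Fin m (index i ↦ i-th set).  Cardinality profiles:
Profile : ℕ → Set
Profile m = Fin m → ℕ

next : ∀ {m} .{{_ : NonZero m}} → Fin m → Fin m
next {m} i = fromℕ< (m%n<n (suc (toℕ i)) m)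

prev : ∀ {m} .{{_ : NonZero m}} → Fin m → Fin m
prev {m} i = fromℕ< (m%n<n (toℕ i + (m ∸ 1)) m)

total : ∀ {m} → Profile m → ℕ
total {m} a = sum (map a (allFin m))

IsRing : ∀ {m} .{{_ : NonZero m}} → Profile m → Set
IsRing {m} a =
  (∀ i → 1 ≤ a i) ×
  (∀ i → a i + a (next i) ≤ m) ×
  (total a ≡ m * (m / 2))

IsBalanced : ∀ {m} .{{_ : NonZero m}} → Profile m → Set
IsBalanced {m} a = ∀ i → a i ≡ m / 2

-- b is a transformation of a: some index i loses one element, and either
-- its successor or its predecessor gains one, all other cardinalities unchanged.
-- (The decreasing index is then automatically unique.)
IsTransformation : ∀ {m} .{{_ : NonZero m}} → Profile m → Profile m → Set
IsTransformation a b =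
  ∃[ i ] ((b i + 1 ≡ a i) ×
    (((b (next i) ≡ a (next i) + 1) × (∀ j → j ≢ i → j ≢ next i → b j ≡ a j))
     ⊎ ((b (prev i) ≡ a (prev i) + 1) × (∀ j → j ≢ i → j ≢ prev i → b j ≡ a j))))

-- Work backwards from φ. Call a position large if it holds more than n = ⌊m/2⌋ elements.
-- Moving one element from a large position i to next i (a shift) undoes a transformation, and
-- keeps the ring conditions provided |A_{i+1}| + |A_{i+2}| < m. An unbalanced ring always admits
-- such a shift: otherwise every large position i forces i + 2 to be large, and as m is odd,
-- steps of 2 reach every position, contradicting Σ |A_i| = m n. A shift into a position with fewer
-- than n elements lowers the total excess Σ (|A_x| − n)⁺; a shift into one with exactly n keeps
-- it but moves excess one step closer to a fixed deficient position. So the lexicographic pair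
-- (excess, distance-weighted excess) decreases until the ring is balanced.

module Submission where

open import Defs
open import Data.Nat using (ℕ; zero; suc; pred; _+_; _*_; _∸_; _≤_; _<_; _≤?_; _<?_; z≤n; s≤s; s≤s⁻¹; NonZero)
open import Data.Nat.Properties hiding (_≟_)
open import Data.Nat.DivMod
open import Data.Nat.Divisibility using (divides)
open import Data.Nat.Induction using (<-wellFounded)
open import Data.Nat.Tactic.RingSolver using (solve-∀)
import Data.Nat.ListAction as List
open import Data.Fin using (Fin; toℕ; fromℕ; inject₁) renaming (zero to fzero; suc to fsuc)
open import Data.Fin.Properties using (toℕ-injective; toℕ-fromℕ<; toℕ<n; _≟_; any?)
open import Data.List using (tabulate)
open import Data.List.Properties using (map-tabulate)
open import Data.Product using (Σ; ∃; ∃-syntax; _×_; _,_; proj₁; proj₂)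
open import Data.Product.Relation.Binary.Lex.Strict using (×-Lex; ×-wellFounded)
open import Data.Sum using (_⊎_; inj₁; inj₂)
open import Algebra.Properties.CommutativeMonoid.Sum +-0-commutativeMonoid
  using (sum; sum-cong-≗; ∑-distrib-+; sum-replicate-zero)
open import Function using (_∘_; id)
open import Induction.WellFounded using (Acc; acc)
open import Level using (0ℓ)
open import Relation.Binary.Core using (Rel)
open import Relation.Binary.Definitions using (tri<; tri≈; tri>)
open import Relation.Binary.Construct.Closure.ReflexiveTransitive using (Star; ε; _◅_; _◅◅_)
open import Relation.Binary.PropositionalEquality
open import Relation.Nullary using (¬_; yes; no; contradiction)
open import Relation.Nullary.Decidable using (_×-dec_)

total≡sum : ∀ {k} (f : Fin k → ℕ) → total f ≡ sum f
total≡sum f = trans (cong List.sum (map-tabulate id f)) (sum-tabulate f)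
  where
  sum-tabulate : ∀ {k} (f : Fin k → ℕ) → List.sum (tabulate f) ≡ sum f
  sum-tabulate {zero} f = refl
  sum-tabulate {suc k} f = cong (f fzero +_) (sum-tabulate (f ∘ fsuc))

sum-const : ∀ k c → sum {k} (λ _ → c) ≡ k * c
sum-const zero c = refl
sum-const (suc k) c = cong (c +_) (sum-const k c)

sum-mono-≤ : ∀ {k} {f g : Fin k → ℕ} → (∀ x → f x ≤ g x) → sum f ≤ sum g
sum-mono-≤ {zero} f≤g = z≤n
sum-mono-≤ {suc k} f≤g = +-mono-≤ (f≤g fzero) (sum-mono-≤ (f≤g ∘ fsuc))

sum-mono-< : ∀ {k} {f g : Fin k → ℕ} → (∀ x → f x ≤ g x) → ∀ i → f i < g i → sum f < sum g
sum-mono-< f≤g fzero     fi<gi = +-mono-<-≤ fi<gi (sum-mono-≤ (f≤g ∘ fsuc))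
sum-mono-< f≤g (fsuc i)  fi<gi = +-mono-≤-< (f≤g fzero) (sum-mono-< (f≤g ∘ fsuc) i fi<gi)

all≥∧sum≡⇒all≡ : ∀ {k c} {f : Fin k → ℕ} → (∀ x → c ≤ f x) → sum f ≡ k * c → ∀ x → f x ≡ c
all≥∧sum≡⇒all≡ {k} {c} c≤f sum≡ x = ≤-antisym (≮⇒≥ c≮fx) (c≤f x)
  where
  c≮fx : ¬ c < _
  c≮fx c<fx = <-irrefl (sym (trans sum≡ (sym (sum-const k c)))) (sum-mono-< c≤f x c<fx)

all≤∧sum≡⇒all≡ : ∀ {k c} {f : Fin k → ℕ} → (∀ x → f x ≤ c) → sum f ≡ k * c → ∀ x → f x ≡ c
all≤∧sum≡⇒all≡ {k} {c} f≤c sum≡ x = ≤-antisym (f≤c x) (≮⇒≥ fx≮c)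
  where
  fx≮c : ¬ _ < c
  fx≮c fx<c = <-irrefl (trans sum≡ (sym (sum-const k c))) (sum-mono-< f≤c x fx<c)

δ : ∀ {k} → Fin k → ℕ → Fin k → ℕ
δ fzero    c fzero    = c
δ fzero    c (fsuc x) = 0
δ (fsuc i) c fzero    = 0
δ (fsuc i) c (fsuc x) = δ i c x

δ-same : ∀ {k} (i : Fin k) c → δ i c i ≡ c
δ-same fzero    c = refl
δ-same (fsuc i) c = δ-same i c

δ-other : ∀ {k} {i x : Fin k} c → x ≢ i → δ i c x ≡ 0
δ-other {i = fzero}  {fzero}  c x≢i = contradiction refl x≢i
δ-other {i = fzero}  {fsuc x} c x≢i = refl
δ-other {i = fsuc i} {fzero}  c x≢i = refl
δ-other {i = fsuc i} {fsuc x} c x≢i = δ-other c (x≢i ∘ cong fsuc)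

sum-δ : ∀ {k} (i : Fin k) c → sum (δ i c) ≡ c
sum-δ {suc k} fzero    c = trans (cong (c +_) (sum-replicate-zero k)) (+-identityʳ c)
sum-δ {suc k} (fsuc i) c = sum-δ i c

sum-exchange : ∀ {k} (f g : Fin k → ℕ) {i j A B} →
               (∀ x → f x + δ i A x ≡ g x + δ j B x) → sum f + A ≡ sum g + B
sum-exchange f g {i} {j} {A} {B} pointwise = begin
  sum f + A                   ≡⟨ cong (sum f +_) (sum-δ i A) ⟨
  sum f + sum (δ i A)         ≡⟨ ∑-distrib-+ f (δ i A) ⟨
  sum (λ x → f x + δ i A x)   ≡⟨ sum-cong-≗ pointwise ⟩
  sum (λ x → g x + δ j B x)   ≡⟨ ∑-distrib-+ g (δ j B) ⟩
  sum g + sum (δ j B)         ≡⟨ cong (sum g +_) (sum-δ j B) ⟩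
  sum g + B                   ∎
  where open ≡-Reasoning

[m+n%d]%d≡[m+n]%d : ∀ m n d .{{_ : NonZero d}} → (m + n % d) % d ≡ (m + n) % d
[m+n%d]%d≡[m+n]%d m n d = begin
  (m + n % d) % d           ≡⟨ %-distribˡ-+ m (n % d) d ⟩
  (m % d + n % d % d) % d   ≡⟨ cong (λ z → (m % d + z) % d) (m%n%n≡m%n n d) ⟩
  (m % d + n % d) % d       ≡⟨ %-distribˡ-+ m n d ⟨
  (m + n) % d               ∎
  where open ≡-Reasoning

[r+x]%d≢x : ∀ {r x d} .{{_ : NonZero d}} → 0 < r → r < d → x < d → (r + x) % d ≢ x
[r+x]%d≢x {r} {x} {d} 0<r r<d x<d with d ≤? r + x
... | no  r+x≱d = <⇒≢ (m<n+m x 0<r) ∘ sym ∘ trans (sym (m<n⇒m%n≡m (≰⇒> r+x≱d)))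
... | yes d≤r+x = <⇒≢ wrapped<x ∘ trans (sym reduce)
  where
  wrapped<x : r + x ∸ d < x
  wrapped<x = subst (r + x ∸ d <_) (m+n∸m≡n d x) (∸-monoˡ-< (+-monoˡ-< x r<d) d≤r+x)
  reduce : (r + x) % d ≡ r + x ∸ d
  reduce = trans (sym (m≤n⇒[n∸m]%m≡n%m d≤r+x)) (m<n⇒m%n≡m (<-trans wrapped<x x<d))

module _ {k : ℕ} where

  private
    m : ℕ
    m = suc k

  mod-cong : ∀ x y → x % m ≡ y % m → x mod m ≡ y mod m
  mod-cong x y eq = toℕ-injective (trans (toℕ-fromℕ< _) (trans eq (sym (toℕ-fromℕ< _))))

  toℕ-mod : (i : Fin m) → toℕ i mod m ≡ i
  toℕ-mod i = toℕ-injective (trans (toℕ-fromℕ< _) (m<n⇒m%n≡m (toℕ<n i)))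

  toℕ-next : (i : Fin m) → toℕ (next i) ≡ suc (toℕ i) % m
  toℕ-next i = toℕ-fromℕ< (m%n<n (suc (toℕ i)) m)

  next-mod : ∀ x → next (x mod m) ≡ suc x mod m
  next-mod x = mod-cong (suc (toℕ (x mod m))) (suc x)
    (trans (cong (λ z → suc z % m) (toℕ-fromℕ< (m%n<n x m))) ([m+n%d]%d≡[m+n]%d 1 x m))

  next²-mod : ∀ x → next (next (x mod m)) ≡ suc (suc x) mod m
  next²-mod x = trans (cong next (next-mod x)) (next-mod (suc x))

  prev-next : (i : Fin m) → prev (next i) ≡ i
  prev-next i = toℕ-injective (begin
    toℕ (prev (next i))           ≡⟨ toℕ-fromℕ< _ ⟩
    (toℕ (next i) + k) % m        ≡⟨ cong (λ z → (z + k) % m) (toℕ-next i) ⟩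
    (suc (toℕ i) % m + k) % m     ≡⟨ cong (_% m) (+-comm (suc (toℕ i) % m) k) ⟩
    (k + suc (toℕ i) % m) % m     ≡⟨ [m+n%d]%d≡[m+n]%d k (suc (toℕ i)) m ⟩
    (k + suc (toℕ i)) % m         ≡⟨ cong (_% m) (trans (+-suc k (toℕ i)) (+-comm m (toℕ i))) ⟩
    (toℕ i + m) % m               ≡⟨ [m+n]%n≡m%n (toℕ i) m ⟩
    toℕ i % m                     ≡⟨ m<n⇒m%n≡m (toℕ<n i) ⟩
    toℕ i                         ∎)
    where open ≡-Reasoning

  next-injective : ∀ {i j : Fin m} → next i ≡ next j → i ≡ j
  next-injective {i} {j} eq = trans (sym (prev-next i)) (trans (cong prev eq) (prev-next j))

  toℕ-next² : (i : Fin m) → toℕ (next (next i)) ≡ (2 + toℕ i) % m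
  toℕ-next² i = trans (cong (toℕ ∘ next ∘ next) (sym (toℕ-mod i))) (trans (cong toℕ (next²-mod (toℕ i))) (toℕ-fromℕ< _))

  next≢id : 1 ≤ k → (i : Fin m) → next i ≢ i
  next≢id 1≤k i eq = [r+x]%d≢x (s≤s z≤n) (s≤s 1≤k) (toℕ<n i) (trans (sym (toℕ-next i)) (cong toℕ eq))

  next²≢id : 2 ≤ k → (i : Fin m) → next (next i) ≢ i
  next²≢id 2≤k i eq = [r+x]%d≢x (s≤s z≤n) (s≤s 2≤k) (toℕ<n i) (trans (sym (toℕ-next² i)) (cong toℕ eq))

  -- gap y z is the number of steps z ↦ suc z % m leading from z to y.
  gap : ℕ → ℕ → ℕ
  gap y z with z ≤? y
  ... | yes _ = y ∸ z
  ... | no  _ = m + y ∸ z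

  gap-suc : ∀ {y z} → z ≢ y → suc z < m → gap y (suc z) < gap y z
  gap-suc {y} {z} z≢y 1+z<m with z ≤? y | suc z ≤? y
  ... | yes _   | yes 1+z≤y = ∸-monoʳ-< (n<1+n z) 1+z≤y
  ... | yes z≤y | no  1+z≰y = contradiction (≤∧≢⇒< z≤y z≢y) 1+z≰y
  ... | no  z≰y | yes 1+z≤y = contradiction (<⇒≤ 1+z≤y) z≰y
  ... | no  _   | no  _     = ∸-monoʳ-< (n<1+n z) (≤-trans (<⇒≤ 1+z<m) (m≤m+n m y))

  gap-wrap : ∀ {y z} → z ≢ y → suc z ≡ m → y < m → gap y 0 < gap y z
  gap-wrap {y} {z} z≢y 1+z≡m y<m with z ≤? y
  ... | yes z≤y = contradiction (≤-antisym z≤y (s≤s⁻¹ (subst (y <_) (sym 1+z≡m) y<m))) z≢y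
  ... | no  _   = subst (y <_) (sym wrapped) (n<1+n y)
    where
    wrapped : m + y ∸ z ≡ suc y
    wrapped = begin
      m + y ∸ z        ≡⟨ cong (λ w → w + y ∸ z) 1+z≡m ⟨
      suc z + y ∸ z    ≡⟨ cong (_∸ z) (+-suc z y) ⟨
      z + suc y ∸ z    ≡⟨ m+n∸m≡n z (suc y) ⟩
      suc y            ∎
      where open ≡-Reasoning

  dist : Fin m → Fin m → ℕ
  dist j x = gap (toℕ j) (toℕ x)

  dist-next : ∀ {j x} → x ≢ j → dist j (next x) < dist j x
  dist-next {j} {x} x≢j with suc (toℕ x) <? m
  ... | yes 1+x<m = subst (λ z → gap (toℕ j) z < dist j x) (sym next≡1+x) (gap-suc (x≢j ∘ toℕ-injective) 1+x<m)
    where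
    next≡1+x : toℕ (next x) ≡ suc (toℕ x)
    next≡1+x = trans (toℕ-next x) (m<n⇒m%n≡m 1+x<m)
  ... | no  1+x≮m = subst (λ z → gap (toℕ j) z < dist j x) (sym next≡0) (gap-wrap (x≢j ∘ toℕ-injective) 1+x≡m (toℕ<n j))
    where
    1+x≡m : suc (toℕ x) ≡ m
    1+x≡m = ≤-antisym (toℕ<n x) (≮⇒≥ 1+x≮m)
    next≡0 : toℕ (next x) ≡ 0
    next≡0 = trans (toℕ-next x) (trans (cong (_% m) 1+x≡m) (n%n≡0 m))

-- 2 (n+1) ≡ 1 modulo 2n+1, so s = (n+1)(j + 2n x) solves 2 s + x ≡ j.
inverse-of-two : ∀ n x j → 2 * (suc n * (j + 2 * n * x)) + x ≡ j + (x + j + 2 * n * x) * suc (2 * n)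
inverse-of-two = solve-∀

module _ (n : ℕ) where

  private
    m : ℕ
    m = suc (2 * n)

  next²-closed⇒all : ∀ {ℓ} (Q : Fin m → Set ℓ) → (∀ i → Q i → Q (next (next i))) →
                     ∀ i₀ → Q i₀ → ∀ j → Q j
  next²-closed⇒all Q closed i₀ Qi₀ j = subst Q hits-j (orbit s)
    where
    x₀ : ℕ
    x₀ = toℕ i₀
    s : ℕ
    s = suc n * (toℕ j + 2 * n * x₀)
    orbit : ∀ t → Q ((2 * t + x₀) mod m)
    orbit zero    = subst Q (sym (toℕ-mod i₀)) Qi₀
    orbit (suc t) = subst Q (trans (next²-mod (2 * t + x₀)) (cong (λ z → (z + x₀) mod m) (sym (*-suc 2 t))))
                      (closed _ (orbit t))
    hits-j : (2 * s + x₀) mod m ≡ j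
    hits-j = trans (mod-cong (2 * s + x₀) (toℕ j)
                     (trans (cong (_% m) (inverse-of-two n x₀ (toℕ j)))
                            ([m+kn]%n≡m%n (toℕ j) (x₀ + toℕ j + 2 * n * x₀) m)))
                   (toℕ-mod j)

module _ {a ℓ} {A : Set a} {T : Rel A ℓ} where

  length : ∀ {x y} → Star T x y → ℕ
  length ε       = 0
  length (_ ◅ p) = suc (length p)

  node : ∀ {x y} (p : Star T x y) → Fin (suc (length p)) → A
  node {x} ε       _        = x
  node {x} (_ ◅ _) fzero    = x
  node     (_ ◅ p) (fsuc j) = node p j

  node-last : ∀ {x y} (p : Star T x y) → node p (fromℕ (length p)) ≡ y
  node-last ε       = refl
  node-last (_ ◅ p) = node-last p

  node-step : ∀ {x y} (p : Star T x y) (j : Fin (length p)) → T (node p (inject₁ j)) (node p (fsuc j))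
  node-step (t ◅ ε)     fzero    = t
  node-step (t ◅ _ ◅ _) fzero    = t
  node-step (_ ◅ p)     (fsuc j) = node-step p j

  node-all : ∀ {ℓ′} {P : A → Set ℓ′} {x y} → P x → (∀ {u v} → T u v → P v) →
             (q : Star T x y) → ∀ j → P (node q j)
  node-all Px _      ε       _        = Px
  node-all Px _      (_ ◅ _) fzero    = Px
  node-all _  target (t ◅ q) (fsuc j) = node-all (target t) target q j

module _ (n : ℕ) (1≤n : 1 ≤ n) where

  private
    m : ℕ
    m = suc (2 * n)

    m≡1+n+n : m ≡ suc (n + n)
    m≡1+n+n = cong (λ z → suc (n + z)) (+-identityʳ n)

  half : m / 2 ≡ n
  half = begin
    suc (2 * n) / 2   ≡⟨ cong (λ z → suc z / 2) (*-comm 2 n) ⟩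
    (1 + n * 2) / 2   ≡⟨ +-distrib-/-∣ʳ 1 {d = 2} (divides n refl) ⟩
    0 + n * 2 / 2     ≡⟨ m*n/n≡m n 2 ⟩
    n                 ∎
    where open ≡-Reasoning

  sum-ring : ∀ {a : Profile m} → IsRing a → sum a ≡ m * n
  sum-ring {a} (_ , _ , total≡) = trans (sym (total≡sum a)) (trans total≡ (cong (m *_) half))

  data Position (i : Fin m) : Fin m → Set where
    source : Position i i
    target : Position i (next i)
    other  : ∀ {x} → x ≢ i → x ≢ next i → Position i x

  position : ∀ i x → Position i x
  position i x with x ≟ i | x ≟ next i
  ... | yes refl | _        = source
  ... | no _     | yes refl = target
  ... | no x≢i   | no x≢i′  = other x≢i x≢i′

  next≢self : (i : Fin m) → next i ≢ i
  next≢self = next≢id (≤-trans 1≤n (m≤m+n n _))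

  next²≢self : (i : Fin m) → next (next i) ≢ i
  next²≢self = next²≢id (*-monoʳ-≤ 2 1≤n)

  shift : Profile m → Fin m → Profile m
  shift a i x with x ≟ i | x ≟ next i
  ... | yes _ | _     = pred (a i)
  ... | no _  | yes _ = suc (a (next i))
  ... | no _  | no _  = a x

  shift-source : ∀ a i → shift a i i ≡ pred (a i)
  shift-source a i with i ≟ i
  ... | yes _   = refl
  ... | no  i≢i = contradiction refl i≢i

  shift-target : ∀ a i → shift a i (next i) ≡ suc (a (next i))
  shift-target a i with next i ≟ i | next i ≟ next i
  ... | yes eq | _      = contradiction eq (next≢self i)
  ... | no _   | yes _  = refl
  ... | no _   | no ≢   = contradiction refl ≢

  shift-other : ∀ a i {x} → x ≢ i → x ≢ next i → shift a i x ≡ a x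
  shift-other a i {x} x≢i x≢i′ with x ≟ i | x ≟ next i
  ... | yes eq | _      = contradiction eq x≢i
  ... | no _   | yes eq = contradiction eq x≢i′
  ... | no _   | no _   = refl

  shift-≤ : ∀ a i {x} → x ≢ next i → shift a i x ≤ a x
  shift-≤ a i {x} x≢i′ with position i x
  ... | source        = ≤-trans (≤-reflexive (shift-source a i)) pred[n]≤n
  ... | target        = contradiction refl x≢i′
  ... | other x≢i _   = ≤-reflexive (shift-other a i x≢i x≢i′)

  sum-shift : ∀ a i (F : Fin m → ℕ → ℕ) {A B} →
              F i (pred (a i)) + A ≡ F i (a i) →
              F (next i) (suc (a (next i))) ≡ F (next i) (a (next i)) + B →
              sum (λ x → F x (shift a i x)) + A ≡ sum (λ x → F x (a x)) + B
  sum-shift a i F {A} {B} at-source at-target =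
    sum-exchange (λ x → F x (shift a i x)) (λ x → F x (a x)) {i} {next i} pointwise
    where
    open ≡-Reasoning
    pointwise : ∀ x → F x (shift a i x) + δ i A x ≡ F x (a x) + δ (next i) B x
    pointwise x with position i x
    ... | source = begin
      F i (shift a i i) + δ i A i      ≡⟨ cong₂ (λ u v → F i u + v) (shift-source a i) (δ-same i A) ⟩
      F i (pred (a i)) + A             ≡⟨ at-source ⟩
      F i (a i)                        ≡⟨ +-identityʳ _ ⟨
      F i (a i) + 0                    ≡⟨ cong (F i (a i) +_) (δ-other B (next≢self i ∘ sym)) ⟨
      F i (a i) + δ (next i) B i       ∎
    ... | target = begin
      F (next i) (shift a i (next i)) + δ i A (next i)  ≡⟨ cong₂ (λ u v → F (next i) u + v) (shift-target a i) (δ-other A (next≢self i)) ⟩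
      F (next i) (suc (a (next i))) + 0                 ≡⟨ +-identityʳ _ ⟩
      F (next i) (suc (a (next i)))                     ≡⟨ at-target ⟩
      F (next i) (a (next i)) + B                       ≡⟨ cong (F (next i) (a (next i)) +_) (δ-same (next i) B) ⟨
      F (next i) (a (next i)) + δ (next i) B (next i)   ∎
    ... | other x≢i x≢i′ = cong₂ (λ u v → F x u + v) (shift-other a i x≢i x≢i′)
                                 (trans (δ-other A x≢i) (sym (δ-other B x≢i′)))

  large⇒neighbour-small : ∀ {x y} → n < x → x + y ≤ m → y ≤ n
  large⇒neighbour-small {x} {y} n<x x+y≤m = +-cancelˡ-≤ x y n (begin
    x + y        ≤⟨ x+y≤m ⟩
    m            ≡⟨ m≡1+n+n ⟩
    suc n + n    ≤⟨ +-monoˡ-≤ n n<x ⟩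
    x + n        ∎)
    where open ≤-Reasoning

  full-pair⇒large : ∀ {y z} → m ≤ y + z → y ≤ n → n < z
  full-pair⇒large {y} {z} m≤y+z y≤n = +-cancelʳ-≤ n (suc n) z (begin
    suc n + n    ≡⟨ m≡1+n+n ⟨
    m            ≤⟨ m≤y+z ⟩
    y + z        ≤⟨ +-monoˡ-≤ z y≤n ⟩
    n + z        ≡⟨ +-comm n z ⟩
    z + n        ∎)
    where open ≤-Reasoning

  Shiftable : Profile m → Fin m → Set
  Shiftable a i = n < a i × a (next i) + a (next (next i)) < m

  1+pred : ∀ {x} → 1 ≤ x → suc (pred x) ≡ x
  1+pred {suc x} _ = refl

  shift-preserves-sum : ∀ a i → 1 ≤ a i → sum (shift a i) ≡ sum a
  shift-preserves-sum a i 1≤ai = +-cancelʳ-≡ 1 _ _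
    (sum-shift a i (λ _ v → v) (trans (+-comm _ 1) (1+pred 1≤ai)) (+-comm 1 _))

  shift-isRing : ∀ {a i} → IsRing a → Shiftable a i → IsRing (shift a i)
  shift-isRing {a} {i} (positive , adjacent , total≡) (n<ai , room) = positive′ , adjacent′ , total≡′
    where
    1≤ai : 1 ≤ a i
    1≤ai = ≤-trans 1≤n (<⇒≤ n<ai)
    positive′ : ∀ x → 1 ≤ shift a i x
    positive′ x with position i x
    ... | source         = subst (1 ≤_) (sym (shift-source a i)) (≤-trans 1≤n (<⇒≤pred n<ai))
    ... | target         = subst (1 ≤_) (sym (shift-target a i)) (s≤s z≤n)
    ... | other x≢i x≢i′ = subst (1 ≤_) (sym (shift-other a i x≢i x≢i′)) (positive x)
    adjacent′ : ∀ x → shift a i x + shift a i (next x) ≤ m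
    adjacent′ x with position i x
    ... | source = begin
      shift a i i + shift a i (next i)  ≡⟨ cong₂ _+_ (shift-source a i) (shift-target a i) ⟩
      pred (a i) + suc (a (next i))     ≡⟨ +-suc (pred (a i)) _ ⟩
      suc (pred (a i)) + a (next i)     ≡⟨ cong (_+ a (next i)) (1+pred 1≤ai) ⟩
      a i + a (next i)                  ≤⟨ adjacent i ⟩
      m                                 ∎
      where open ≤-Reasoning
    ... | target = subst (_≤ m) (sym (cong₂ _+_ (shift-target a i) (shift-other a i i″≢i i″≢i′))) room
      where
      i″≢i : next (next i) ≢ i
      i″≢i = next²≢self i
      i″≢i′ : next (next i) ≢ next i
      i″≢i′ = next≢self (next i)
    ... | other x≢i x≢i′ = ≤-trans (+-mono-≤ (shift-≤ a i x≢i′) (shift-≤ a i (x≢i ∘ next-injective)))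
                          (adjacent x)
    total≡′ : total (shift a i) ≡ m * (m / 2)
    total≡′ = begin
      total (shift a i)   ≡⟨ total≡sum (shift a i) ⟩
      sum (shift a i)     ≡⟨ shift-preserves-sum a i 1≤ai ⟩
      sum a               ≡⟨ total≡sum a ⟨
      total a             ≡⟨ total≡ ⟩
      m * (m / 2)         ∎
      where open ≡-Reasoning

  -- Read backwards, a shift is a transformation: next i gives its extra element back to
  -- prev (next i) = i.
  shift-isTransformation : ∀ a i → 1 ≤ a i → IsTransformation (shift a i) a
  shift-isTransformation a i 1≤ai =
    next i , trans (+-comm (a (next i)) 1) (sym (shift-target a i)) ,
    inj₂ (subst (λ x → a x ≡ shift a i x + 1) (sym (prev-next i)) gives-back , unchanged)
    where
    gives-back : a i ≡ shift a i i + 1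
    gives-back = sym (trans (cong (_+ 1) (shift-source a i)) (trans (+-comm _ 1) (1+pred 1≤ai)))
    unchanged : ∀ x → x ≢ next i → x ≢ prev (next i) → a x ≡ shift a i x
    unchanged x x≢i′ x≢i = sym (shift-other a i (λ x≡i → x≢i (trans x≡i (sym (prev-next i)))) x≢i′)

  excess : Profile m → ℕ
  excess a = sum (λ x → a x ∸ n)

  weight : Fin m → Profile m → ℕ
  weight j a = sum (λ x → (a x ∸ n) * dist j x)

  suc-pred-∸ : ∀ {x} → n < x → suc (pred x ∸ n) ≡ x ∸ n
  suc-pred-∸ {suc x} n<1+x = sym (+-∸-assoc 1 (s≤s⁻¹ n<1+x))

  v∸n≡0 : ∀ {v} → v ≡ n → v ∸ n ≡ 0
  v∸n≡0 refl = n∸n≡0 n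

  1+v∸n≡1 : ∀ {v} → v ≡ n → suc v ∸ n ≡ 1
  1+v∸n≡1 refl = m+n∸n≡m 1 n

  excess-shift-< : ∀ a i → n < a i → a (next i) < n → excess (shift a i) < excess a
  excess-shift-< a i n<ai ai′<n = ≤-reflexive (trans (+-comm 1 _) (trans moved (+-identityʳ _)))
    where
    moved : excess (shift a i) + 1 ≡ excess a + 0
    moved = sum-shift a i (λ _ v → v ∸ n) (trans (+-comm _ 1) (suc-pred-∸ n<ai))
              (trans (m≤n⇒m∸n≡0 ai′<n) (sym (trans (+-identityʳ _) (m≤n⇒m∸n≡0 (<⇒≤ ai′<n)))))

  excess-shift-≡ : ∀ a i → n < a i → a (next i) ≡ n → excess (shift a i) ≡ excess a
  excess-shift-≡ a i n<ai ai′≡n = +-cancelʳ-≡ 1 _ _ (sum-shift a i (λ _ v → v ∸ n)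
    (trans (+-comm _ 1) (suc-pred-∸ n<ai))
    (trans (1+v∸n≡1 ai′≡n) (cong (_+ 1) (sym (v∸n≡0 ai′≡n)))))

  weight-shift-< : ∀ {a i j} → n < a i → a (next i) ≡ n → i ≢ j → weight j (shift a i) < weight j a
  weight-shift-< {a} {i} {j} n<ai ai′≡n i≢j =
    +-cancelʳ-< _ _ _ (subst (_< weight j a + dist j i) (sym moved) (+-monoʳ-< (weight j a) (dist-next i≢j)))
    where
    d′ : ℕ
    d′ = dist j (next i)
    moved : weight j (shift a i) + dist j i ≡ weight j a + d′
    moved = sum-shift a i (λ x v → (v ∸ n) * dist j x)
      (trans (+-comm _ (dist j i)) (cong (_* dist j i) (suc-pred-∸ n<ai)))
      (trans (cong (_* d′) (1+v∸n≡1 ai′≡n)) (trans (*-identityˡ d′) (cong (λ v → v * d′ + d′) (sym (v∸n≡0 ai′≡n)))))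

  large-exists : ∀ {a j} → IsRing a → a j < n → ∃ λ i → n < a i
  large-exists {a} {j} ring aj<n with any? (λ i → n <? a i)
  ... | yes large = large
  ... | no  none  = contradiction (all≤∧sum≡⇒all≡ (λ x → ≮⇒≥ (none ∘ (x ,_))) (sum-ring ring) j) (<⇒≢ aj<n)

  not-all-large : ∀ {a} → IsRing a → ¬ (∀ i → n < a i)
  not-all-large {a} ring all-large =
    <⇒≢ (all-large fzero) (sym (all≥∧sum≡⇒all≡ (<⇒≤ ∘ all-large) (sum-ring ring) fzero))

  shiftable-exists : ∀ {a} → IsRing a → ∃ (λ i → n < a i) → ∃ (Shiftable a)
  shiftable-exists {a} ring@(_ , adjacent , _) (i₀ , n<ai₀)
    with any? (λ i → (n <? a i) ×-dec (a (next i) + a (next (next i)) <? m))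
  ... | yes shiftable = shiftable
  ... | no  none      = contradiction (next²-closed⇒all n (λ i → n < a i) propagate i₀ n<ai₀) (not-all-large ring)
    where
    propagate : ∀ i → n < a i → n < a (next (next i))
    propagate i n<ai = full-pair⇒large (≮⇒≥ (none ∘ (i ,_) ∘ (n<ai ,_))) (large⇒neighbour-small n<ai (adjacent i))

  balanced-or-deficient : ∀ {a} → IsRing a → IsBalanced a ⊎ ∃ λ j → a j < n
  balanced-or-deficient {a} ring with any? (λ j → a j <? n)
  ... | yes deficient = inj₂ deficient
  ... | no  none      = inj₁ λ x → trans (all≥∧sum≡⇒all≡ (λ y → ≮⇒≥ (none ∘ (y ,_))) (sum-ring ring) x) (sym half)

  Step : Profile m → Profile m → Set
  Step a b = IsRing b × IsTransformation a b

  shift-step : ∀ {a i} → IsRing a → Shiftable a i → Step (shift a i) a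
  shift-step {a} {i} ring (n<ai , _) = ring , shift-isTransformation a i (≤-trans 1≤n (<⇒≤ n<ai))

  Reachable : Profile m → Set
  Reachable b = ∃ λ a → IsBalanced a × IsRing a × Star Step a b

  _▷_ : ∀ {b c} → Reachable b → Step b c → Reachable c
  (a , balanced , ring , path) ▷ step = a , balanced , ring , path ◅◅ (step ◅ ε)

  _<ₗₑₓ_ : Rel (ℕ × ℕ) 0ℓ
  _<ₗₑₓ_ = ×-Lex _≡_ _<_ _<_

  descend : ∀ {a j} → IsRing a → a j < n → Acc _<ₗₑₓ_ (excess a , weight j a) → Reachable a
  descend {a} {j} ring@(_ , adjacent , _) aj<n (acc smaller) with shiftable-exists ring (large-exists ring aj<n)
  ... | i , shiftable@(n<ai , _) with <-cmp (a (next i)) n | balanced-or-deficient (shift-isRing ring shiftable)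
  ...   | tri< _ _ _     | inj₁ balanced     =
    (shift a i , balanced , shift-isRing ring shiftable , ε) ▷ shift-step ring shiftable
  ...   | tri< ai′<n _ _ | inj₂ (j′ , bj′<n) =
    descend {j = j′} (shift-isRing ring shiftable) bj′<n (smaller (inj₁ (excess-shift-< a i n<ai ai′<n)))
    ▷ shift-step ring shiftable
  ...   | tri≈ _ ai′≡n _ | _                 =
    descend {j = j} (shift-isRing ring shiftable) bj<n
      (smaller (inj₂ (excess-shift-≡ a i n<ai ai′≡n , weight-shift-< n<ai ai′≡n i≢j)))
    ▷ shift-step ring shiftable
    where
    i≢j : i ≢ j
    i≢j refl = <-asym n<ai aj<n
    j≢i′ : j ≢ next i
    j≢i′ j≡i′ = <⇒≢ aj<n (trans (cong a j≡i′) ai′≡n)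
    bj<n : shift a i j < n
    bj<n = subst (_< n) (sym (shift-other a i (i≢j ∘ sym) j≢i′)) aj<n
  ...   | tri> _ _ n<ai′ | _                 = contradiction (large⇒neighbour-small n<ai (adjacent i)) (<⇒≱ n<ai′)

  reachable : ∀ {a} → IsRing a → Reachable a
  reachable {a} ring with balanced-or-deficient ring
  ... | inj₁ balanced      = a , balanced , ring , ε
  ... | inj₂ (j , aj<n)    = descend ring aj<n (×-wellFounded <-wellFounded <-wellFounded _)

proposition2p8 : (n : ℕ) → 2 ≤ n → (φ : Profile (suc (2 * n))) → IsRing φ → ¬ IsBalanced φ →
    ∃[ k ] Σ (Fin (suc (suc k)) → Profile (suc (2 * n))) (λ seq →
    (∀ j → IsRing (seq j)) ×
    IsBalanced (seq fzero) ×
    (∀ i → seq (fromℕ (suc k)) i ≡ φ i) ×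
    (∀ (j : Fin (suc k)) → IsTransformation (seq (inject₁ j)) (seq (fsuc j))))
proposition2p8 n 2≤n φ ring unbalanced with reachable n (≤-trans (s≤s z≤n) 2≤n) ring
... | _ , balanced , _     , ε = contradiction balanced unbalanced
... | _ , balanced , ring₀ , path@(_ ◅ rest) =
  length rest , node path , node-all ring₀ proj₁ path , balanced ,
  cong-app (node-last path) , proj₂ ∘ node-step path
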